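{- Let $\underline F$ be a fragment of length $\ell\ge2$ and let $i$ be an index with $0\le i\le\ell-2$ at which $\underline F$ exhibits a cross, i.e. $F_i^\uparrow=F_i^\downarrow=\mathrm{Dom}_{i+1}(\underline F)$. Set $\delta_{i-1}=1$ if $F_{i-1}^\uparrow\sim F_{i-1}^\downarrow$ and $\delta_{i-1}=0$ otherwise. Then: (i) every $\underline w=(w_0,\dots,w_{\ell-1})\in\mathcal W(\underline F)$ satisfies $w_i=0$; (ii) for $w_0,\dots,w_{\ell-2}\in\{0,1\}$, we have $(w_0,\dots,w_{\ell-2})\in\mathcal W(\underline F^{(i)})$ if and only if $(w_0,\dots,w_{i-1},0,w_i,\dots,w_{\ell-2})\in\mathcal W(\underline F)$ and $(w_{i-1},w_i)\neq(\delta_{i-1},1)$, where $\underline F^{(i)}=(F_0,\dots,F_{i-1},F_{i+1},\dots,F_{\ell-1})$ is obtained by deleting the $i$-th column.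
   Context: Fragments. A fragment of length $\ell\ge1$ is a tuple $\underline F=(F_0,\dots,F_{\ell-1})$ of pairs $F_i=(F_i^\uparrow,F_i^\downarrow)\in\{\mathbf{A},\mathbf{B},\mathbf{AB},\mathbf{0}\}^2$ (formal symbols) such that: exactly one of $F_0^\uparrow,F_0^\downarrow$ equals $\mathbf{0}$; for $i>0$, $F_i^\uparrow,F_i^\downarrow\ne\mathbf 0$; for $i<\ell-1$, $F_i^\uparrow,F_i^\downarrow\ne\mathbf{AB}$; if $\ell>1$, exactly one of $F_{\ell-1}^\uparrow,F_{\ell-1}^\downarrow$ equals $\mathbf{AB}$. Dominant letter (for $\ell\ge2$). The letter $\mathbf A$ occurs in the symbols $\mathbf A$ and $\mathbf{AB}$, the letter $\mathbf B$ in $\mathbf B$ and $\mathbf{AB}$. For $0\le j\le\ell-1$, $\mathrm{Dom}_j(\underline F)\in\{\mathbf A,\mathbf B\}$ is the letter occurring more often than the other one among the two entries $F_j^\uparrow,F_j^\downarrow$, and if they occur equally often, $\mathrm{Dom}_j(\underline F)=\mathrm{Dom}_{j+1}(\underline F)$. Fragmentary weights. Let $\sim$ be the equivalence relation on symbols with classes $\{\mathbf{A},\mathbf{AB}\}$ and $\{\mathbf{B},\mathbf{0}\}$. For a set $W$ of tuples and $c\in\{0,1\}$, $W\times\{c\}$ is the set of tuples obtained by appending $c$. For a tuple $\underline F=(F_0,\dots,F_{\ell-1})$ of pairs of symbols define $W_i^{(b,b)},W_i^{(a,b)},W_i^{(b,a)}\subset\{0,1\}^{i+1}$: $W_0^{(b,b)}=\emptyset$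 if $\ell=1$ and ($F_0^\uparrow\in\{\mathbf A,\mathbf B\}$ or $F_0^\downarrow\in\{\mathbf A,\mathbf B\}$), else $\{(1)\}$; $W_0^{(a,b)}=\emptyset$ if $F_0^\downarrow=\mathbf 0$, else $\{(0)\}$; $W_0^{(b,a)}=\emptyset$ if $F_0^\uparrow=\mathbf 0$, else $\{(0)\}$; for $1\le i\le\ell-1$: $W_i^{(b,b)}=(W_{i-1}^{(a,b)}\cup W_{i-1}^{(b,a)})\times\{1\}$ if $F_{i-1}^\uparrow\sim F_{i-1}^\downarrow$, else $W_{i-1}^{(b,b)}\times\{1\}$; $W_i^{(a,b)}=W_{i-1}^{(a,b)}\times\{0\}$ if $F_i^\uparrow\sim F_{i-1}^\uparrow$, else $(W_{i-1}^{(b,a)}\cup W_{i-1}^{(b,b)})\times\{0\}$; $W_i^{(b,a)}=W_{i-1}^{(b,a)}\times\{0\}$ if $F_i^\downarrow\sim F_{i-1}^\downarrow$, else $(W_{i-1}^{(a,b)}\cup W_{i-1}^{(b,b)})\times\{0\}$. Then $\mathcal W(\underline F)=W_{\ell-1}^{(b,b)}\cup W_{\ell-1}^{(a,b)}$ if $F_{\ell-1}^\downarrow=\mathbf{AB}$; $=W_{\ell-1}^{(b,b)}\cup W_{\ell-1}^{(b,a)}$ if $F_{\ell-1}^\uparrow=\mathbf{AB}$; $=W_0^{(b,b)}\cup W_0^{(a,b)}\cup W_0^{(b,a)}$ otherwise. -}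

module Defs where

open import Data.Bool using (Bool; true; false; if_then_else_; _∧_; _∨_; not; _xor_)
open import Data.Nat using (ℕ; zero; suc; _<_; _≤_)
open import Data.List using (List; []; _∷_; _++_; map; length; take; drop; [_]; _∷ʳ_)
open import Data.List.Relation.Unary.All using (All)
open import Data.Fin using (Fin; toℕ)
open import Data.Maybe using (Maybe; just; nothing)
open import Data.Product using (_×_; _,_; proj₁; proj₂; ∃)
open import Data.Unit using (⊤)
open import Relation.Binary.PropositionalEquality using (_≡_; _≢_)
open import Relation.Nullary using (¬_)

-- Formal symbols A, B, AB, 0  (O stands for the symbol 0)
data Sym : Set where
  A B AB O : Sym

Col : Set
Col = Sym × Sym

up down : Col → Sym
up = proj₁
down = proj₂

data Letter : Set where
  𝐀 𝐁 : Letter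

letterSym : Letter → Sym
letterSym 𝐀 = A
letterSym 𝐁 = B

isO : Sym → Bool
isO O = true
isO _ = false

isAB : Sym → Bool
isAB AB = true
isAB _ = false

isAorB : Sym → Bool
isAorB A = true
isAorB B = true
isAorB _ = false

-- classes of ~ : {A, AB} (true) and {B, 0} (false)
cls : Sym → Bool
cls A = true
cls AB = true
cls B = false
cls O = false

-- x ~ y, as a boolean; also used as the bit δ (true = 1, false = 0)
sim : Sym → Sym → Bool
sim x y = not (cls x xor cls y)

-- Bits: false = 0, true = 1.  Words (w_0,...,w_k) are lists of bits.
Word : Set
Word = List Bool

_at_ : {X : Set} → List X → ℕ → Maybe X
[] at _ = nothing
(x ∷ xs) at zero = just x
(x ∷ xs) at suc n = xs at n

ExactlyOne : Bool → Bool → Set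
ExactlyOne b c = (b xor c) ≡ true

record IsFragment (F : List Col) : Set where
  field
    nonempty : 1 ≤ length F
    col0     : ∀ (k : Fin (length F)) → toℕ k ≡ 0 →
               ExactlyOne (isO (up (Data.List.lookup F k))) (isO (down (Data.List.lookup F k)))
    noO      : ∀ (k : Fin (length F)) → 0 < toℕ k →
               (up (Data.List.lookup F k) ≢ O) × (down (Data.List.lookup F k) ≢ O)
    noAB     : ∀ (k : Fin (length F)) → suc (toℕ k) < length F →
               (up (Data.List.lookup F k) ≢ AB) × (down (Data.List.lookup F k) ≢ AB)
    lastAB   : 1 < length F → ∀ (k : Fin (length F)) → suc (toℕ k) ≡ length F →
               ExactlyOne (isAB (up (Data.List.lookup F k))) (isAB (down (Data.List.lookup F k)))

occA occB : Sym → ℕ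
occA A = 1
occA AB = 1
occA _ = 0
occB B = 1
occB AB = 1
occB _ = 0

-- Dom applied to the tail (F_j, F_{j+1}, ...) gives Dom_j(F);
-- nothing if the tie is never broken (does not happen for fragments).
Dom : List Col → Maybe Letter
Dom [] = nothing
Dom ((u , d) ∷ cs) with Data.Nat._<ᵇ_ (occB u Data.Nat.+ occB d) (occA u Data.Nat.+ occA d)
                      | Data.Nat._<ᵇ_ (occA u Data.Nat.+ occA d) (occB u Data.Nat.+ occB d)
... | true  | _     = just 𝐀
... | false | true  = just 𝐁
... | false | false = Dom cs

Cross : List Col → ℕ → Set
Cross F i = ∃ λ (L : Letter) → ∃ λ (c : Col) →
  (F at i ≡ just c) × (up c ≡ letterSym L) × (down c ≡ letterSym L) ×
  (Dom (drop (suc i) F) ≡ just L)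

-- Fragmentary weights.  Finite sets of words are represented as lists;
-- W × {c} appends c to every word.
_×′_ : List Word → Bool → List Word
W ×′ c = map (_∷ʳ c) W

record Triple : Set where
  constructor triple
  field
    Wbb Wab Wba : List Word
open Triple

-- W_0 ; the first argument says whether ℓ = 1
W0 : Bool → Col → Triple
W0 ℓ≡1 (u , d) = triple
  (if ℓ≡1 ∧ (isAorB u ∨ isAorB d) then [] else [ [ true ] ])
  (if isO d then [] else [ [ false ] ])
  (if isO u then [] else [ [ false ] ])

-- W_i from W_{i-1}, given F_{i-1} (prev) and F_i (cur)
Wstep : Col → Col → Triple → Triple
Wstep prev cur (triple bb ab ba) = triple
  (if sim (up prev) (down prev) then (ab ++ ba) ×′ true else bb ×′ true)
  (if sim (up cur) (up prev) then ab ×′ false else (ba ++ bb) ×′ false)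
  (if sim (down cur) (down prev) then ba ×′ false else (ab ++ bb) ×′ false)

-- run through the remaining columns; returns W_{ℓ-1} and F_{ℓ-1}
Wrun : Triple → Col → List Col → Triple × Col
Wrun t prev [] = t , prev
Wrun t prev (c ∷ cs) = Wrun (Wstep prev c t) c cs

isNil : List Col → Bool
isNil [] = true
isNil (_ ∷ _) = false

𝒲 : List Col → List Word
𝒲 [] = []
𝒲 (c ∷ cs) with Wrun (W0 (isNil cs) c) c cs
... | triple bb ab ba , (u , d) =
  if isAB d then bb ++ ab
  else if isAB u then bb ++ ba
  else (Wbb t0 ++ Wab t0 ++ Wba t0)
  where t0 = W0 (isNil cs) c

deleteCol : ℕ → List Col → List Col
deleteCol i F = take i F ++ drop (suc i) F

insert0 : ℕ → Word → Word
insert0 i w = take i w ++ false ∷ drop i w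

-- (w_{i-1}, w_i) ≠ (δ_{i-1}, 1).  For i = 0 the condition is vacuous
-- (a cross at i = 0 is impossible for a fragment anyway).
Cond : List Col → ℕ → Word → Set
Cond F zero w = ⊤
Cond F (suc j) w = ∀ (c : Col) → F at j ≡ just c →
  ¬ ((w at j ≡ just (sim (up c) (down c))) × (w at suc j ≡ just true))

-- Membership of a word in 𝒲(F) is decided by a deterministic automaton that reads one bit per
-- column; its state records which of W^(b,b), W^(a,b), W^(b,a) contain the prefix read so far.
-- Since Dom_{i+1} = L, the columns behind a cross are ties (A,B)/(B,A) up to an (L,L) column or
-- the final column, and along such a tail acceptance depends only on bb and on the strands
-- carrying L.  After a 1 at the cross all of these are empty from the next column on, which
-- gives (i).  After a 0 they are what they would be had the column been deleted, except
-- possibly bb when the next bit is 1; that difference vanishes unless (w_{i-1}, w_i) = (δ_{i-1}, 1),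
-- and in that case the shortened fragment rejects the word anyway, which gives (ii).
module Submission where

open import Defs
open import Data.Bool using (Bool; true; false; _∧_; _∨_; not; _xor_; if_then_else_; T)
import Data.Bool as Bool
open import Data.Bool.Properties
  using (T-≡; T-not-≡; if-eta; if-cong-then; if-cong-else; ∧-zeroʳ; ∨-identityʳ; ∨-comm)
open import Data.Empty using (⊥-elim)
open import Data.Fin using (toℕ) renaming (zero to fzero; suc to fsuc)
open import Data.List using (List; []; _∷_; _++_; length; take; drop; [_]; _∷ʳ_; lookup)
open import Data.List.Membership.Propositional using (_∈_)
open import Data.List.Membership.Propositional.Properties
  using (∈-map⁺; ∈-map⁻; ∈-++⁺ˡ; ∈-++⁺ʳ; ∈-++⁻)
open import Data.List.Properties
  using (≡-dec; ∷ʳ-injective; ∷ʳ-++; ++-identityʳ; length-++; ++-conicalʳ; drop-[])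
open import Data.List.Membership.DecPropositional (≡-dec Bool._≟_) using (_∈?_)
open import Data.List.Relation.Unary.All as All using (All; []; _∷_)
open import Data.List.Relation.Unary.All.Properties using (++⁺; map⁺)
open import Data.Maybe using (just)
open import Data.Maybe.Properties using (just-injective)
open import Data.Nat using (ℕ; zero; suc; _+_; _≤_; _<_; _∸_; s≤s; z≤n)
open import Data.Nat.Properties using (+-comm; +-suc; suc-injective)
open import Data.Product using (_×_; _,_; proj₁; proj₂; Σ; ∃₂)
import Data.Product as Product
open import Data.Product.Function.NonDependent.Propositional using (_×-⇔_)
open import Data.Sum using ([_,_]′)
open import Function.Base using (_∘_)
open import Function.Bundles using (_⇔_; mk⇔; Equivalence)
open import Function.Properties.Equivalence using ()
  renaming (refl to ⇔-refl; sym to ⇔-sym; trans to ⇔-trans)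
open import Relation.Binary.PropositionalEquality
  using (_≡_; _≢_; refl; sym; trans; cong; cong₂; subst; subst₂; module ≡-Reasoning)
open import Relation.Nullary using (¬_; yes; no; does)
open import Relation.Nullary.Decidable using (does-⇔; _×-dec_; _⊎-dec_)
open import Relation.Nullary.Decidable.Core using (T?)

open ≡-Reasoning

record State : Set where
  constructor ⟨_,_,_⟩
  field
    bb ab ba : Bool
open State

⟨⟩-cong : ∀ {x x′ y y′ z z′} → x ≡ x′ → y ≡ y′ → z ≡ z′ → ⟨ x , y , z ⟩ ≡ ⟨ x′ , y′ , z′ ⟩
⟨⟩-cong refl refl refl = refl

dead : State
dead = ⟨ false , false , false ⟩

δ : Col → Bool
δ c = sim (up c) (down c)

step : Col → Col → State → Bool → State
step p c s b =
  ⟨ b ∧ (if δ p then ab s ∨ ba s else bb s)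
  , not b ∧ (if sim (up c) (up p) then ab s else ba s ∨ bb s)
  , not b ∧ (if sim (down c) (down p) then ba s else ab s ∨ bb s) ⟩

headBit : List Bool → Bool
headBit []      = false
headBit (b ∷ _) = b

-- A missing bit is read as 0; runs are only ever used on words of the right length.
run : State → Col → List Col → List Bool → State
run s p []       bs = s
run s p (c ∷ cs) bs = run (step p c s (headBit bs)) c cs (drop 1 bs)

-- Mirrors 𝒲 for a last column containing AB, the only case for fragments of length ≥ 2.
accepts : State → Col → Bool
accepts s (u , d) = if isAB d then bb s ∨ ab s else if isAB u then bb s ∨ ba s else false

lastOf : {X : Set} → X → List X → X
lastOf x []       = x
lastOf x (y ∷ ys) = lastOf y ys

lastOf-++ : {X : Set} (x : X) (ys zs : List X) → lastOf x (ys ++ zs) ≡ lastOf (lastOf x ys) zs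
lastOf-++ x []       zs = refl
lastOf-++ x (y ∷ ys) zs = lastOf-++ y ys zs

run-++ : ∀ s p cs ds (u v : List Bool) → length u ≡ length cs →
  run s p (cs ++ ds) (u ++ v) ≡ run (run s p cs u) (lastOf p cs) ds v
run-++ s p []       ds []      v _   = refl
run-++ s p (c ∷ cs) ds (b ∷ u) v len = run-++ (step p c s b) c cs ds u v (suc-injective len)

step-dead : ∀ p c b → step p c dead b ≡ dead
step-dead p c b = ⟨⟩-cong
  (trans (cong (b ∧_) (if-eta (δ p))) (∧-zeroʳ b))
  (trans (cong (not b ∧_) (if-eta (sim (up c) (up p)))) (∧-zeroʳ (not b)))
  (trans (cong (not b ∧_) (if-eta (sim (down c) (down p)))) (∧-zeroʳ (not b)))

run-dead : ∀ p cs r → accepts (run dead p cs r) (lastOf p cs) ≡ false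
run-dead (u , d) [] r rewrite if-eta (isAB u) {false} = if-eta (isAB d)
run-dead p (c ∷ cs) r rewrite step-dead p c (headBit r) = run-dead c cs (drop 1 r)

-- Words of W^(b,b) end in 1, those of W^(a,b) and W^(b,a) in 0.
Consistent : Bool → State → Set
Consistent true  s = ab s ∨ ba s ≡ false
Consistent false s = bb s ≡ false

step-consistent : ∀ p c s b → Consistent b (step p c s b)
step-consistent p c s true  = refl
step-consistent p c s false = refl

run-consistent : ∀ {a} s p cs u → Consistent a s → length u ≡ length cs →
  Consistent (lastOf a u) (run s p cs u)
run-consistent s p []       []      con _   = con
run-consistent s p (c ∷ cs) (b ∷ u) _   len =
  run-consistent (step p c s b) c cs u (step-consistent p c s b) (suc-injective len)

crossCol : Letter → Col
crossCol L = letterSym L , letterSym L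

data Tie : Col → Set where
  A∣B : Tie (A , B)
  B∣A : Tie (B , A)

data EndCol (L : Letter) : Col → Set where
  AB↓ : EndCol L (letterSym L , AB)
  AB↑ : EndCol L (AB , letterSym L)

data Dominated (L : Letter) : List Col → Set where
  cross : ∀ {cs} → Dominated L (crossCol L ∷ cs)
  end   : ∀ {c} → EndCol L c → Dominated L [ c ]
  tie   : ∀ {c cs} → Tie c → Dominated L cs → Dominated L (c ∷ cs)

record Agree (L : Letter) (c : Col) (X Y : State) : Set where
  field
    bb≡ : bb X ≡ bb Y
    ab≡ : up c ≡ letterSym L → ab X ≡ ab Y
    ba≡ : down c ≡ letterSym L → ba X ≡ ba Y
open Agree

-- Behind a tie, the strand carrying L in c continues the one carrying L in p, merged with bb
-- when it switches rows.
Agree-step : ∀ {L p X Y} c b → Tie p → Agree L p X Y →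
  Agree L c (step p c X b) (step p c Y b)
Agree-step {𝐀} (u , d) b A∣B ag = record
  { bb≡ = cong (b ∧_) (bb≡ ag)
  ; ab≡ = λ { refl → cong (not b ∧_) (ab≡ ag refl) }
  ; ba≡ = λ { refl → cong (not b ∧_) (cong₂ _∨_ (ab≡ ag refl) (bb≡ ag)) } }
Agree-step {𝐀} (u , d) b B∣A ag = record
  { bb≡ = cong (b ∧_) (bb≡ ag)
  ; ab≡ = λ { refl → cong (not b ∧_) (cong₂ _∨_ (ba≡ ag refl) (bb≡ ag)) }
  ; ba≡ = λ { refl → cong (not b ∧_) (ba≡ ag refl) } }
Agree-step {𝐁} (u , d) b A∣B ag = record
  { bb≡ = cong (b ∧_) (bb≡ ag)
  ; ab≡ = λ { refl → cong (not b ∧_) (cong₂ _∨_ (ba≡ ag refl) (bb≡ ag)) }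
  ; ba≡ = λ { refl → cong (not b ∧_) (ba≡ ag refl) } }
Agree-step {𝐁} (u , d) b B∣A ag = record
  { bb≡ = cong (b ∧_) (bb≡ ag)
  ; ab≡ = λ { refl → cong (not b ∧_) (ab≡ ag refl) }
  ; ba≡ = λ { refl → cong (not b ∧_) (cong₂ _∨_ (ab≡ ag refl) (bb≡ ag)) } }

Agree-cross : ∀ {L X Y} → Agree L (crossCol L) X Y → X ≡ Y
Agree-cross ag = ⟨⟩-cong (bb≡ ag) (ab≡ ag refl) (ba≡ ag refl)

Agree-accepts : ∀ {L c X Y} → EndCol L c → Agree L c X Y → accepts X c ≡ accepts Y c
Agree-accepts       AB↓ ag = cong₂ _∨_ (bb≡ ag) (ab≡ ag refl)
Agree-accepts {𝐀}   AB↑ ag = cong₂ _∨_ (bb≡ ag) (ba≡ ag refl)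
Agree-accepts {𝐁}   AB↑ ag = cong₂ _∨_ (bb≡ ag) (ba≡ ag refl)

Agree-run : ∀ {L c cs X Y} r → Dominated L (c ∷ cs) → Agree L c X Y →
  accepts (run X c cs r) (lastOf c cs) ≡ accepts (run Y c cs r) (lastOf c cs)
Agree-run {L} {cs = cs} r cross ag =
  cong (λ S → accepts (run S (crossCol L) cs r) (lastOf (crossCol L) cs)) (Agree-cross ag)
Agree-run r (end e) ag = Agree-accepts e ag
Agree-run {cs = []}    r (tie t ()) ag
Agree-run {cs = _ ∷ _} r (tie t d)  ag = Agree-run (drop 1 r) d (Agree-step _ (headBit r) t ag)

cross-one : ∀ L p c s b →
  Agree L c (step (crossCol L) c (step p (crossCol L) s true) b) (step (crossCol L) c dead b)
cross-one 𝐀 p (u , d) s b = record { bb≡ = refl ; ab≡ = λ { refl → refl } ; ba≡ = λ { refl → refl } }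
cross-one 𝐁 p (u , d) s b = record { bb≡ = refl ; ab≡ = λ { refl → refl } ; ba≡ = λ { refl → refl } }

cross-one-rejects : ∀ {L} p t cs s r → Dominated L (t ∷ cs) →
  accepts (run (step p (crossCol L) s true) (crossCol L) (t ∷ cs) r) (lastOf t cs) ≡ false
cross-one-rejects {L} p t cs s r dom = begin
  accepts (run (step x t (step p x s true) b) t cs r′) (lastOf t cs)
    ≡⟨ Agree-run r′ dom (cross-one L p t s b) ⟩
  accepts (run (step x t dead b) t cs r′) (lastOf t cs)
    ≡⟨ cong (λ S → accepts (run S t cs r′) (lastOf t cs)) (step-dead x t b) ⟩
  accepts (run dead t cs r′) (lastOf t cs)
    ≡⟨ run-dead t cs r′ ⟩
  false ∎
  where
  x : Col
  x = crossCol L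
  b : Bool
  b = headBit r
  r′ : List Bool
  r′ = drop 1 r

∨-false-comm : ∀ y z → (z ∨ false) ∨ (y ∨ false) ≡ y ∨ z
∨-false-comm y z rewrite ∨-identityʳ z | ∨-identityʳ y = ∨-comm z y

-- The arguments l, u, d stand for the ~-classes of L, F_{i-1}^↑ and F_{i-1}^↓.  The hypothesis
-- forces u ≠ d after a 1 (only bb alive) and u = d after a 0 (bb dead); both sides are then bb,
-- respectively ab ∨ ba.
merge-strands : ∀ l u d x y z a → Consistent a ⟨ x , y , z ⟩ → a ≢ not (u xor d) →
  (if not (l xor u) then y else z ∨ x) ∨ (if not (l xor d) then z else y ∨ x)
    ≡ (if not (u xor d) then y ∨ z else x)
merge-strands _     _     _     _ true  _     true  () _
merge-strands _     _     _     _ false true  true  () _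
merge-strands _     true  true  _ false false true  _  ne = ⊥-elim (ne refl)
merge-strands _     false false _ false false true  _  ne = ⊥-elim (ne refl)
merge-strands true  true  false x false false true  _  _  = refl
merge-strands false true  false x false false true  _  _  = ∨-identityʳ x
merge-strands true  false true  x false false true  _  _  = ∨-identityʳ x
merge-strands false false true  x false false true  _  _  = refl
merge-strands _     true  false _ _     _     false _  ne = ⊥-elim (ne refl)
merge-strands _     false true  _ _     _     false _  ne = ⊥-elim (ne refl)
merge-strands true  true  true  _ y     z     false refl _ = refl
merge-strands false false false _ y     z     false refl _ = refl
merge-strands true  false false _ y     z     false refl _ = ∨-false-comm y z
merge-strands false true  true  _ y     z     false refl _ = ∨-false-comm y z

cross-zero : ∀ {a} L p c s b → Consistent a s → ¬ (a ≡ δ p × b ≡ true) →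
  Agree L c (step (crossCol L) c (step p (crossCol L) s false) b) (step p c s b)
cross-zero {a} L p (u , d) s b con ok = record
  { bb≡ = bb-merged L b ok
  ; ab≡ = ab-kept L
  ; ba≡ = ba-kept L }
  where
  bb-merged : ∀ L b → ¬ (a ≡ δ p × b ≡ true) →
    bb (step (crossCol L) (u , d) (step p (crossCol L) s false) b) ≡ bb (step p (u , d) s b)
  bb-merged L false _ = refl
  bb-merged 𝐀 true ok =
    merge-strands true (cls (up p)) (cls (down p)) (bb s) (ab s) (ba s) a con (λ e → ok (e , refl))
  bb-merged 𝐁 true ok =
    merge-strands false (cls (up p)) (cls (down p)) (bb s) (ab s) (ba s) a con (λ e → ok (e , refl))
  ab-kept : ∀ L → u ≡ letterSym L →
    ab (step (crossCol L) (u , d) (step p (crossCol L) s false) b) ≡ ab (step p (u , d) s b)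
  ab-kept 𝐀 refl = refl
  ab-kept 𝐁 refl = refl
  ba-kept : ∀ L → d ≡ letterSym L →
    ba (step (crossCol L) (u , d) (step p (crossCol L) s false) b) ≡ ba (step p (u , d) s b)
  ba-kept 𝐀 refl = refl
  ba-kept 𝐁 refl = refl

excluded-bb : ∀ a q x y z → Consistent a ⟨ x , y , z ⟩ → a ≡ q → (if q then y ∨ z else x) ≡ false
excluded-bb true  .true  x y z con refl = con
excluded-bb false .false x y z con refl = con

step-excluded : ∀ {a} p c s → Consistent a s → a ≡ δ p → step p c s true ≡ dead
step-excluded {a} p c s con a≡δ =
  cong (λ β → ⟨ β , false , false ⟩) (excluded-bb a (δ p) (bb s) (ab s) (ba s) con a≡δ)

skip-cross : ∀ {L a} p t cs s b r → Dominated L (t ∷ cs) → Consistent a s →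
  (accepts (run s p (t ∷ cs) (b ∷ r)) (lastOf t cs) ≡ true)
    ⇔ (accepts (run (step p (crossCol L) s false) (crossCol L) (t ∷ cs) (b ∷ r)) (lastOf t cs) ≡ true
       × ¬ (a ≡ δ p × b ≡ true))
skip-cross {L} {a} p t cs s b r dom con with (a Bool.≟ δ p) ×-dec (b Bool.≟ true)
... | yes (a≡δ , refl) = mk⇔ (λ acc → ⊥-elim (false≢true (trans (sym rejected) acc)))
                               (λ (_ , ok) → ⊥-elim (ok (a≡δ , refl)))
  where
  false≢true : false ≢ true
  false≢true ()
  rejected : accepts (run s p (t ∷ cs) (true ∷ r)) (lastOf t cs) ≡ false
  rejected = begin
    accepts (run (step p t s true) t cs r) (lastOf t cs)
      ≡⟨ cong (λ S → accepts (run S t cs r) (lastOf t cs)) (step-excluded p t s con a≡δ) ⟩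
    accepts (run dead t cs r) (lastOf t cs)
      ≡⟨ run-dead t cs r ⟩
    false ∎
... | no ok = mk⇔ (λ acc → trans same acc , ok) (λ (acc , _) → trans (sym same) acc)
  where
  same : accepts (run (step (crossCol L) t (step p (crossCol L) s false) b) t cs r) (lastOf t cs)
       ≡ accepts (run (step p t s b) t cs r) (lastOf t cs)
  same = Agree-run r dom (cross-zero L p t s b con ok)

_∈ᵇ_ : List Bool → List (List Bool) → Bool
w ∈ᵇ X = does (w ∈? X)

∈⇔∈ᵇ : ∀ {w X} → w ∈ X ⇔ (w ∈ᵇ X ≡ true)
∈⇔∈ᵇ {w} {X} with w ∈? X
... | yes w∈X = mk⇔ (λ _ → refl) (λ _ → w∈X)
... | no  w∉X = mk⇔ (λ w∈X → ⊥-elim (w∉X w∈X)) (λ ())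

∈ᵇ-++ : ∀ {w} X Y → w ∈ᵇ (X ++ Y) ≡ w ∈ᵇ X ∨ w ∈ᵇ Y
∈ᵇ-++ {w} X Y = does-⇔ (mk⇔ (∈-++⁻ X) [ ∈-++⁺ˡ , ∈-++⁺ʳ X ]′) (w ∈? X ++ Y) ((w ∈? X) ⊎-dec (w ∈? Y))

∈-×′⇔ : ∀ {v b} X c → (v ∷ʳ b ∈ X ×′ c) ⇔ (b ≡ c × v ∈ X)
∈-×′⇔ {v} {b} X c = mk⇔ to from
  where
  to : v ∷ʳ b ∈ X ×′ c → b ≡ c × v ∈ X
  to v∷ʳb∈ with ∈-map⁻ (_∷ʳ c) v∷ʳb∈
  ... | x , x∈X , eq with ∷ʳ-injective v x eq
  ... | refl , refl = refl , x∈X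
  from : b ≡ c × v ∈ X → v ∷ʳ b ∈ X ×′ c
  from (refl , v∈X) = ∈-map⁺ (_∷ʳ c) v∈X

bit⇔ : ∀ {b} c → b ≡ c ⇔ T (if c then b else not b)
bit⇔ true  = ⇔-sym T-≡
bit⇔ false = ⇔-sym T-not-≡

∈ᵇ-×′ : ∀ {v b} X c → (v ∷ʳ b) ∈ᵇ (X ×′ c) ≡ (if c then b else not b) ∧ v ∈ᵇ X
∈ᵇ-×′ {v} {b} X c =
  does-⇔ (⇔-trans (∈-×′⇔ X c) (bit⇔ c ×-⇔ ⇔-refl)) (v ∷ʳ b ∈? X ×′ c) (T? _ ×-dec (v ∈? X))

∈ᵇ-if-×′ : ∀ {v b} q X Y c →
  (v ∷ʳ b) ∈ᵇ (if q then X ×′ c else Y ×′ c) ≡ (if c then b else not b) ∧ (if q then v ∈ᵇ X else v ∈ᵇ Y)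
∈ᵇ-if-×′ true  X Y c = ∈ᵇ-×′ X c
∈ᵇ-if-×′ false X Y c = ∈ᵇ-×′ Y c

memberships : Triple → List Bool → State
memberships (triple bb ab ba) w = ⟨ w ∈ᵇ bb , w ∈ᵇ ab , w ∈ᵇ ba ⟩

memberships-Wstep : ∀ p c t v b → memberships (Wstep p c t) (v ∷ʳ b) ≡ step p c (memberships t v) b
memberships-Wstep p c (triple bb ab ba) v b = ⟨⟩-cong
  (trans (∈ᵇ-if-×′ (δ p) (ab ++ ba) bb true)
         (cong (b ∧_) (if-cong-then (δ p) (∈ᵇ-++ ab ba))))
  (trans (∈ᵇ-if-×′ (sim (up c) (up p)) ab (ba ++ bb) false)
         (cong (not b ∧_) (if-cong-else (sim (up c) (up p)) (∈ᵇ-++ ba bb))))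
  (trans (∈ᵇ-if-×′ (sim (down c) (down p)) ba (ab ++ bb) false)
         (cong (not b ∧_) (if-cong-else (sim (down c) (down p)) (∈ᵇ-++ ab bb))))

memberships-Wrun : ∀ t p cs v bs → length bs ≡ length cs →
  memberships (proj₁ (Wrun t p cs)) (v ++ bs) ≡ run (memberships t v) p cs bs
memberships-Wrun t p []       v []       _   = cong (memberships t) (++-identityʳ v)
memberships-Wrun t p (c ∷ cs) v (b ∷ bs) len = begin
  memberships (proj₁ (Wrun (Wstep p c t) c cs)) (v ++ b ∷ bs)
    ≡⟨ cong (memberships (proj₁ (Wrun (Wstep p c t) c cs))) (sym (∷ʳ-++ v b bs)) ⟩
  memberships (proj₁ (Wrun (Wstep p c t) c cs)) (v ∷ʳ b ++ bs)
    ≡⟨ memberships-Wrun (Wstep p c t) c cs (v ∷ʳ b) bs (suc-injective len) ⟩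
  run (memberships (Wstep p c t) (v ∷ʳ b)) c cs bs
    ≡⟨ cong (λ s → run s c cs bs) (memberships-Wstep p c t v b) ⟩
  run (step p c (memberships t v) b) c cs bs ∎

Wrun-last : ∀ t p cs → proj₂ (Wrun t p cs) ≡ lastOf p cs
Wrun-last t p []       = refl
Wrun-last t p (c ∷ cs) = Wrun-last (Wstep p c t) c cs

start : Col → Bool → State
start c0 w0 = memberships (W0 false c0) [ w0 ]

start-consistent : ∀ c0 w0 → Consistent w0 (start c0 w0)
start-consistent (u , d) false = refl
start-consistent (u , d) true with isO u | isO d
... | true  | true  = refl
... | true  | false = refl
... | false | true  = refl
... | false | false = refl

accepting : Triple × Col → List (List Bool)
accepting (triple bb ab ba , (u , d)) = if isAB d then bb ++ ab else if isAB u then bb ++ ba else []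

∈ᵇ-accepting : ∀ t col w → w ∈ᵇ accepting (t , col) ≡ accepts (memberships t w) col
∈ᵇ-accepting (triple bb ab ba) (u , d) w with isAB d | isAB u
... | true  | _     = ∈ᵇ-++ bb ab
... | false | true  = ∈ᵇ-++ bb ba
... | false | false = refl

𝒲-accepting : ∀ {M} c0 c cs → EndCol M (lastOf c cs) →
  𝒲 (c0 ∷ c ∷ cs) ≡ accepting (Wrun (W0 false c0) c0 (c ∷ cs))
𝒲-accepting {M} c0 c cs e = helper M (subst (EndCol M) (sym (Wrun-last (W0 false c0) c0 (c ∷ cs))) e)
  where
  helper : ∀ M → EndCol M (proj₂ (Wrun (W0 false c0) c0 (c ∷ cs))) →
    𝒲 (c0 ∷ c ∷ cs) ≡ accepting (Wrun (W0 false c0) c0 (c ∷ cs))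
  helper M e′ with Wrun (W0 false c0) c0 (c ∷ cs)
  helper M AB↓ | triple bb ab ba , _ = refl
  helper 𝐀 AB↑ | triple bb ab ba , _ = refl
  helper 𝐁 AB↑ | triple bb ab ba , _ = refl

∈𝒲⇔accepts : ∀ {M} c0 cs w0 v → cs ≢ [] → EndCol M (lastOf c0 cs) → length v ≡ length cs →
  (w0 ∷ v ∈ 𝒲 (c0 ∷ cs)) ⇔ (accepts (run (start c0 w0) c0 cs v) (lastOf c0 cs) ≡ true)
∈𝒲⇔accepts c0 []       w0 v cs≢[] _ _   = ⊥-elim (cs≢[] refl)
∈𝒲⇔accepts c0 (c ∷ cs) w0 v _     e len =
  subst (λ β → (w0 ∷ v ∈ 𝒲 (c0 ∷ c ∷ cs)) ⇔ (β ≡ true)) accepted ∈⇔∈ᵇ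
  where
  R : Triple × Col
  R = Wrun (W0 false c0) c0 (c ∷ cs)
  accepted : (w0 ∷ v) ∈ᵇ 𝒲 (c0 ∷ c ∷ cs) ≡ accepts (run (start c0 w0) c0 (c ∷ cs) v) (lastOf c cs)
  accepted = begin
    (w0 ∷ v) ∈ᵇ 𝒲 (c0 ∷ c ∷ cs)
      ≡⟨ cong ((w0 ∷ v) ∈ᵇ_) (𝒲-accepting c0 c cs e) ⟩
    (w0 ∷ v) ∈ᵇ accepting R
      ≡⟨ ∈ᵇ-accepting (proj₁ R) (proj₂ R) (w0 ∷ v) ⟩
    accepts (memberships (proj₁ R) (w0 ∷ v)) (proj₂ R)
      ≡⟨ cong₂ accepts (memberships-Wrun (W0 false c0) c0 (c ∷ cs) [ w0 ] v len)
                       (Wrun-last (W0 false c0) c0 (c ∷ cs)) ⟩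
    accepts (run (start c0 w0) c0 (c ∷ cs) v) (lastOf c cs) ∎

∈𝒲⇔resumed : ∀ {M} c0 G cs w0 u v → cs ≢ [] → EndCol M (lastOf (lastOf c0 G) cs) →
  length u ≡ length G → length v ≡ length cs →
  (w0 ∷ u ++ v ∈ 𝒲 (c0 ∷ G ++ cs))
    ⇔ (accepts (run (run (start c0 w0) c0 G u) (lastOf c0 G) cs v) (lastOf (lastOf c0 G) cs) ≡ true)
∈𝒲⇔resumed {M} c0 G cs w0 u v cs≢[] e |u| |v| =
  subst (λ β → (w0 ∷ u ++ v ∈ 𝒲 (c0 ∷ G ++ cs)) ⇔ (β ≡ true))
    (cong₂ accepts (run-++ (start c0 w0) c0 G cs u v |u|) (lastOf-++ c0 G cs))
    (∈𝒲⇔accepts c0 (G ++ cs) w0 (u ++ v) (cs≢[] ∘ ++-conicalʳ G cs)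
      (subst (EndCol M) (sym (lastOf-++ c0 G cs)) e)
      (trans (length-++ u) (trans (cong₂ _+_ |u| |v|) (sym (length-++ G)))))

OfLength : ℕ → List (List Bool) → Set
OfLength n = All (λ w → length w ≡ n)

record TripleOfLength (n : ℕ) (t : Triple) : Set where
  field
    bb-length : OfLength n (Triple.Wbb t)
    ab-length : OfLength n (Triple.Wab t)
    ba-length : OfLength n (Triple.Wba t)
open TripleOfLength

OfLength-if : ∀ {n X Y} q → OfLength n X → OfLength n Y → OfLength n (if q then X else Y)
OfLength-if true  hX _  = hX
OfLength-if false _  hY = hY

OfLength-×′ : ∀ {n X} c → OfLength n X → OfLength (suc n) (X ×′ c)
OfLength-×′ c hX = map⁺ (All.map (λ {v} |v| → trans (length-∷ʳ v) (cong suc |v|)) hX)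
  where
  length-∷ʳ : ∀ v → length (v ∷ʳ c) ≡ suc (length v)
  length-∷ʳ v = trans (length-++ v) (+-comm (length v) 1)

Wstep-length : ∀ {n} p c t → TripleOfLength n t → TripleOfLength (suc n) (Wstep p c t)
Wstep-length p c (triple bb ab ba) h = record
  { bb-length = OfLength-if (δ p)
      (OfLength-×′ true (++⁺ (ab-length h) (ba-length h))) (OfLength-×′ true (bb-length h))
  ; ab-length = OfLength-if (sim (up c) (up p))
      (OfLength-×′ false (ab-length h)) (OfLength-×′ false (++⁺ (ba-length h) (bb-length h)))
  ; ba-length = OfLength-if (sim (down c) (down p))
      (OfLength-×′ false (ba-length h)) (OfLength-×′ false (++⁺ (ab-length h) (bb-length h))) }

Wrun-length : ∀ {n} t p cs → TripleOfLength n t → TripleOfLength (length cs + n) (proj₁ (Wrun t p cs))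
Wrun-length     t p []       h = h
Wrun-length {n} t p (c ∷ cs) h =
  subst (λ m → TripleOfLength m (proj₁ (Wrun (Wstep p c t) c cs))) (+-suc (length cs) n)
    (Wrun-length (Wstep p c t) c cs (Wstep-length p c t h))

W0-length : ∀ c0 → TripleOfLength 1 (W0 false c0)
W0-length (u , d) = record
  { bb-length = refl ∷ []
  ; ab-length = OfLength-if (isO d) [] (refl ∷ [])
  ; ba-length = OfLength-if (isO u) [] (refl ∷ []) }

accepting-length : ∀ {n} t col → TripleOfLength n t → OfLength n (accepting (t , col))
accepting-length (triple bb ab ba) (u , d) h with isAB d | isAB u
... | true  | _     = ++⁺ (bb-length h) (ab-length h)
... | false | true  = ++⁺ (bb-length h) (ba-length h)
... | false | false = []

𝒲-length : ∀ {M} c0 cs {w} → cs ≢ [] → EndCol M (lastOf c0 cs) → w ∈ 𝒲 (c0 ∷ cs) →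
  length w ≡ suc (length cs)
𝒲-length c0 []           cs≢[] _ _  = ⊥-elim (cs≢[] refl)
𝒲-length c0 (c ∷ cs) {w} _     e w∈ =
  trans (All.lookup lengths (subst (w ∈_) (𝒲-accepting c0 c cs e) w∈)) (+-comm (length (c ∷ cs)) 1)
  where
  R : Triple × Col
  R = Wrun (W0 false c0) c0 (c ∷ cs)
  lengths : OfLength (length (c ∷ cs) + 1) (accepting R)
  lengths = accepting-length (proj₁ R) (proj₂ R) (Wrun-length (W0 false c0) c0 (c ∷ cs) (W0-length c0))

data InnerCol : Col → Set where
  letters : ∀ L M → InnerCol (letterSym L , letterSym M)

-- The columns F_1, …, F_{ℓ-1} of a fragment of length ℓ ≥ 2.
data Body : List Col → Set where
  last : ∀ {L c} → EndCol L c → Body [ c ]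
  _∷_  : ∀ {c cs} → InnerCol c → Body cs → Body (c ∷ cs)

letter : ∀ u → u ≢ O → u ≢ AB → Σ Letter λ L → letterSym L ≡ u
letter A  _   _    = 𝐀 , refl
letter B  _   _    = 𝐁 , refl
letter AB _   u≢AB = ⊥-elim (u≢AB refl)
letter O  u≢O _    = ⊥-elim (u≢O refl)

inner-col : ∀ c → (up c ≢ O) × (down c ≢ O) → (up c ≢ AB) × (down c ≢ AB) → InnerCol c
inner-col (u , d) (u≢O , d≢O) (u≢AB , d≢AB)
  with letter u u≢O u≢AB | letter d d≢O d≢AB
... | L , refl | M , refl = letters L M

end-col : ∀ c → (up c ≢ O) × (down c ≢ O) → ExactlyOne (isAB (up c)) (isAB (down c)) →
  Σ Letter λ L → EndCol L c
end-col (A  , AB) _           _  = 𝐀 , AB↓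
end-col (B  , AB) _           _  = 𝐁 , AB↓
end-col (AB , A ) _           _  = 𝐀 , AB↑
end-col (AB , B ) _           _  = 𝐁 , AB↑
end-col (O  , _ ) (u≢O , _)   _  = ⊥-elim (u≢O refl)
end-col (_  , O ) (_   , d≢O) _  = ⊥-elim (d≢O refl)
end-col (A  , A ) _           ()
end-col (A  , B ) _           ()
end-col (B  , A ) _           ()
end-col (B  , B ) _           ()
end-col (AB , AB) _           ()

Body-lookup : ∀ cs → cs ≢ [] →
  (∀ k → (up (lookup cs k) ≢ O) × (down (lookup cs k) ≢ O)) →
  (∀ k → suc (toℕ k) < length cs → (up (lookup cs k) ≢ AB) × (down (lookup cs k) ≢ AB)) →
  (∀ k → suc (toℕ k) ≡ length cs → ExactlyOne (isAB (up (lookup cs k))) (isAB (down (lookup cs k)))) →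
  Body cs
Body-lookup []           cs≢[] _   _    _     = ⊥-elim (cs≢[] refl)
Body-lookup (c ∷ [])     _     noO _    oneAB = last (proj₂ (end-col c (noO fzero) (oneAB fzero refl)))
Body-lookup (c ∷ c′ ∷ cs) _    noO noAB oneAB =
  inner-col c (noO fzero) (noAB fzero (s≤s (s≤s z≤n)))
  ∷ Body-lookup (c′ ∷ cs) (λ ()) (noO ∘ fsuc) (λ k → noAB (fsuc k) ∘ s≤s) (λ k → oneAB (fsuc k) ∘ cong suc)

fragment-body : ∀ c0 cs → IsFragment (c0 ∷ cs) → 2 ≤ length (c0 ∷ cs) → Body cs
fragment-body c0 []       _    (s≤s ())
fragment-body c0 (c ∷ cs) frag two = Body-lookup (c ∷ cs) (λ ())
  (λ k → IsFragment.noO frag (fsuc k) (s≤s z≤n))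
  (λ k lt → IsFragment.noAB frag (fsuc k) (s≤s lt))
  (λ k eq → IsFragment.lastAB frag two (fsuc k) (cong suc eq))

Body-drop : ∀ n {cs} → Body cs → drop n cs ≢ [] → Body (drop n cs)
Body-drop zero    body       _  = body
Body-drop (suc n) (last _)   ne = ⊥-elim (ne (drop-[] n))
Body-drop (suc n) (_ ∷ body) ne = Body-drop n body ne

Body-last : ∀ {cs} y → Body cs → Σ Letter λ M → EndCol M (lastOf y cs)
Body-last y (last e)          = _ , e
Body-last y (_∷_ {c} _ body) = Body-last c body

Dom-end : ∀ {L c} → EndCol L c → Dom [ c ] ≡ just L
Dom-end {𝐀} AB↓ = refl
Dom-end {𝐁} AB↓ = refl
Dom-end {𝐀} AB↑ = refl
Dom-end {𝐁} AB↑ = refl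

dominated : ∀ {L cs} → Body cs → Dom cs ≡ just L → Dominated L cs
dominated (last e) dom with just-injective (trans (sym (Dom-end e)) dom)
... | refl = end e
dominated (letters 𝐀 𝐀 ∷ _)    refl = cross
dominated (letters 𝐁 𝐁 ∷ _)    refl = cross
dominated (letters 𝐀 𝐁 ∷ body) dom  = tie A∣B (dominated body dom)
dominated (letters 𝐁 𝐀 ∷ body) dom  = tie B∣A (dominated body dom)

Dom-nonempty : ∀ {L} cs → Dom cs ≡ just L → cs ≢ []
Dom-nonempty [] () refl

no-cross-at-start : ∀ F → IsFragment F → ¬ Cross F 0
no-cross-at-start []        _    (_ , _ , () , _)
no-cross-at-start (c0 ∷ cs) frag (L , _ , refl , c↑ , c↓ , _) =
  letters-have-no-O L (subst₂ (λ u d → ExactlyOne (isO u) (isO d)) c↑ c↓ (IsFragment.col0 frag fzero refl))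
  where
  letters-have-no-O : ∀ L → ¬ ExactlyOne (isO (letterSym L)) (isO (letterSym L))
  letters-have-no-O 𝐀 ()
  letters-have-no-O 𝐁 ()

at-split : ∀ {X : Set} (xs : List X) j {x} → xs at j ≡ just x →
  xs ≡ take j xs ++ x ∷ drop (suc j) xs × length (take j xs) ≡ j
at-split (y ∷ ys) zero    refl = refl , refl
at-split (y ∷ ys) (suc j) eq   = Product.map (cong (y ∷_)) (cong suc) (at-split ys j eq)

at-lastOf : ∀ {X : Set} (x : X) ys zs → (x ∷ ys ++ zs) at length ys ≡ just (lastOf x ys)
at-lastOf x []       zs = refl
at-lastOf x (y ∷ ys) zs = at-lastOf y ys zs

at-++ : ∀ {X : Set} ys (z : X) zs → (ys ++ z ∷ zs) at length ys ≡ just z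
at-++ []       z zs = refl
at-++ (y ∷ ys) z zs = at-++ ys z zs

split-length : ∀ {X : Set} (w : List X) n m → length w ≡ n + m →
  ∃₂ λ u v → w ≡ u ++ v × length u ≡ n × length v ≡ m
split-length w       zero    m len = [] , w , refl , refl , len
split-length []      (suc n) m ()
split-length (x ∷ w) (suc n) m len with split-length w n m (suc-injective len)
... | u , v , refl , |u| , |v| = x ∷ u , v , refl , cong suc |u| , |v|

insert0-++ : ∀ w0 u v n → length u ≡ n → insert0 (suc n) (w0 ∷ u ++ v) ≡ w0 ∷ u ++ false ∷ v
insert0-++ w0 []      v zero    _   = refl
insert0-++ w0 (y ∷ u) v (suc n) len = cong (w0 ∷_) (insert0-++ y u v n (suc-injective len))

Cond⇔ : ∀ F j w {p a b} → F at j ≡ just p → w at j ≡ just a → w at suc j ≡ just b →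
  Cond F (suc j) w ⇔ (¬ (a ≡ δ p × b ≡ true))
Cond⇔ F j w {p} F-at w-at w-at′ = mk⇔ to from
  where
  to : Cond F (suc j) w → ¬ (_ ≡ δ p × _ ≡ true)
  to cond (refl , refl) = cond p F-at (w-at , w-at′)
  from : ¬ (_ ≡ δ p × _ ≡ true) → Cond F (suc j) w
  from ok c F-at″ (wδ , w1) with just-injective (trans (sym F-at) F-at″)
  ... | refl = ok (just-injective (trans (sym w-at) wδ) , just-injective (trans (sym w-at′) w1))

CrossClaims : List Col → ℕ → List Col → Set
CrossClaims F i F′ =
  (∀ (w : Word) → w ∈ 𝒲 F → w at i ≡ just false)
  × (∀ (w : Word) → length w ≡ length F ∸ 1 → (w ∈ 𝒲 F′ ⇔ (insert0 i w ∈ 𝒲 F × Cond F i w)))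

module Crossing {L M : Letter} (c0 : Col) (G : List Col) (t : Col) (T : List Col)
                (dom : Dominated L (t ∷ T)) (endcol : EndCol M (lastOf t T)) where

  x : Col
  x = crossCol L

  p : Col
  p = lastOf c0 G

  F : List Col
  F = c0 ∷ G ++ x ∷ t ∷ T

  nonempty : G ++ x ∷ t ∷ T ≢ []
  nonempty eq with ++-conicalʳ G (x ∷ t ∷ T) eq
  ... | ()

  endcol-F : EndCol M (lastOf c0 (G ++ x ∷ t ∷ T))
  endcol-F = subst (EndCol M) (sym (lastOf-++ c0 G (x ∷ t ∷ T))) endcol

  prefix : Bool → List Bool → State
  prefix w0 u = run (start c0 w0) c0 G u

  one-rejected : ∀ w0 u r → length u ≡ length G → length r ≡ length (t ∷ T) →
    ¬ (w0 ∷ u ++ true ∷ r ∈ 𝒲 F)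
  one-rejected w0 u r |u| |r| w∈ with trans (sym (cross-one-rejects p t T (prefix w0 u) r dom))
    (Equivalence.to (∈𝒲⇔resumed c0 G (x ∷ t ∷ T) w0 u (true ∷ r) (λ ()) endcol |u| (cong suc |r|)) w∈)
  ... | ()

  cross-bit-is-zero : ∀ w → w ∈ 𝒲 F → w at suc (length G) ≡ just false
  cross-bit-is-zero [] w∈ with 𝒲-length c0 (G ++ x ∷ t ∷ T) nonempty endcol-F w∈
  ... | ()
  cross-bit-is-zero (w0 ∷ w′) w∈
    with split-length w′ (length G) (length (x ∷ t ∷ T))
           (trans (suc-injective (𝒲-length c0 (G ++ x ∷ t ∷ T) nonempty endcol-F w∈)) (length-++ G))
  ... | u , [] , _ , _ , ()
  ... | u , false ∷ r , refl , |u| , _ = subst (λ n → (u ++ false ∷ r) at n ≡ just false) |u| (at-++ u false r)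
  ... | u , true ∷ r , refl , |u| , |br| = ⊥-elim (one-rejected w0 u r |u| (suc-injective |br|) w∈)

  deletion : ∀ w → length w ≡ length F ∸ 1 →
    (w ∈ 𝒲 (c0 ∷ G ++ t ∷ T) ⇔ (insert0 (suc (length G)) w ∈ 𝒲 F × Cond F (suc (length G)) w))
  deletion w len
    with split-length w (suc (length G)) (length (t ∷ T)) (trans len (trans (length-++ G) (+-suc (length G) _)))
  ... | [] , _ , _ , () , _
  ... | _ , [] , _ , _ , ()
  ... | w0 ∷ u , b ∷ r , refl , |w0u| , |br|
    rewrite insert0-++ w0 u (b ∷ r) (length G) (suc-injective |w0u|) =
      ⇔-trans skipped (⇔-trans (skip-cross p t T s b r dom consistent) (⇔-sym crossed ×-⇔ ⇔-sym condition))
    where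
    |u| : length u ≡ length G
    |u| = suc-injective |w0u|
    s : State
    s = prefix w0 u
    consistent : Consistent (lastOf w0 u) s
    consistent = run-consistent (start c0 w0) c0 G u (start-consistent c0 w0) |u|
    skipped : (w0 ∷ u ++ b ∷ r ∈ 𝒲 (c0 ∷ G ++ t ∷ T))
      ⇔ (accepts (run s p (t ∷ T) (b ∷ r)) (lastOf t T) ≡ true)
    skipped = ∈𝒲⇔resumed c0 G (t ∷ T) w0 u (b ∷ r) (λ ()) endcol |u| |br|
    crossed : (w0 ∷ u ++ false ∷ b ∷ r ∈ 𝒲 F)
      ⇔ (accepts (run (step p x s false) x (t ∷ T) (b ∷ r)) (lastOf t T) ≡ true)
    crossed = ∈𝒲⇔resumed c0 G (x ∷ t ∷ T) w0 u (false ∷ b ∷ r) (λ ()) endcol |u| (cong suc |br|)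
    condition : Cond F (suc (length G)) (w0 ∷ u ++ b ∷ r) ⇔ (¬ (lastOf w0 u ≡ δ p × b ≡ true))
    condition = Cond⇔ F (length G) (w0 ∷ u ++ b ∷ r) (at-lastOf c0 G (x ∷ t ∷ T))
      (subst (λ n → (w0 ∷ u ++ b ∷ r) at n ≡ just (lastOf w0 u)) |u| (at-lastOf w0 u (b ∷ r)))
      (subst (λ n → (u ++ b ∷ r) at n ≡ just b) |u| (at-++ u b r))

crossing-claims : ∀ {L M} c0 G T → Dominated L T → EndCol M (lastOf (crossCol L) T) →
  CrossClaims (c0 ∷ G ++ crossCol L ∷ T) (suc (length G)) (c0 ∷ G ++ T)
crossing-claims c0 G []      ()
crossing-claims c0 G (t ∷ T) dom endcol =
  Crossing.cross-bit-is-zero c0 G t T dom endcol , Crossing.deletion c0 G t T dom endcol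

theorem3p3p1 : (F : List Col) → IsFragment F → 2 ≤ length F →
    (i : ℕ) → i + 2 ≤ length F → Cross F i →
    (∀ (w : Word) → w ∈ 𝒲 F → w at i ≡ just false)
    × (∀ (w : Word) → length w ≡ length F ∸ 1 →
    (w ∈ 𝒲 (deleteCol i F) ⇔ (insert0 i w ∈ 𝒲 F × Cond F i w)))
theorem3p3p1 F frag _ zero _ cr = ⊥-elim (no-cross-at-start F frag cr)
theorem3p3p1 [] _ () (suc j) _ _
theorem3p3p1 (c0 ∷ cs) frag two (suc j) _ (L , c , c-at , c↑ , c↓ , dom) =
  subst₂ (λ cs′ j′ → CrossClaims (c0 ∷ cs′) (suc j′) (c0 ∷ before ++ after)) (sym cs≡) |before|
    (crossing-claims c0 before after (dominated body dom) (proj₂ (Body-last (crossCol L) body)))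
  where
  before after : List Col
  before = take j cs
  after  = drop (suc j) cs
  split : cs ≡ before ++ crossCol L ∷ after × length before ≡ j
  split = at-split cs j (subst (λ c′ → cs at j ≡ just c′) (cong₂ _,_ c↑ c↓) c-at)
  cs≡ : cs ≡ before ++ crossCol L ∷ after
  cs≡ = proj₁ split
  |before| : length before ≡ j
  |before| = proj₂ split
  body : Body after
  body = Body-drop (suc j) (fragment-body c0 cs frag two) (Dom-nonempty after dom)
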